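{- For every $m\ge 2$, the following program returns $G=R_m$, and at the end of the for loop $t=0$: set $G=[m-1]$ and $t=m-2$; for $j=1$ to $2^{m-2}-1$, let $v=v_2(j)$, append $[t,t+1,t+2,\ldots,t+v+1]\cup[t+v]$ to $G$, and then replace $t$ by $t+v-1$; return $G$.
   Context: $v_2(j)$ denotes the largest integer $v$ such that $2^v$ divides $j$. $\cup$ denotes concatenation of sequences. The sequences $R_m$ are defined by $R_2=[1]$ and $R_m=(R_{m-1}+1)\cup[1,2,\ldots,m-1]\cup R_{m-1}$ for $m\ge3$, where $R_{m-1}+1$ adds $1$ to each entry. -}

module Defs where

open import Data.Nat as ℕ using (ℕ; zero; suc; _∸_; _^_)
open import Data.Nat.DivMod using (_/_; _%_)
open import Data.Integer as ℤ using (ℤ; +_)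
open import Data.List using (List; []; _∷_; _++_; map; applyUpTo; foldl; [_])
open import Data.Product using (_×_; _,_)

-- 2-adic valuation v₂(j) for j ≥ 1 (largest v with 2^v ∣ j), computed by
-- repeated halving; the fuel argument (≥ j suffices) ensures termination.
v2-fuel : ℕ → ℕ → ℕ
v2-fuel zero    n = 0
v2-fuel (suc f) zero = 0
v2-fuel (suc f) (suc n) with (suc n) % 2
... | zero  = suc (v2-fuel f (suc n / 2))
... | suc _ = 0

v2 : ℕ → ℕ
v2 j = v2-fuel j j

-- The sequences R_m : R_2 = [1],  R_m = (R_{m-1}+1) ∪ [1,…,m-1] ∪ R_{m-1}.
-- (R_0, R_1 are unused placeholders.)
R : ℕ → List ℕ
R zero = []
R (suc zero) = []
R (suc (suc zero)) = [ 1 ]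
R (suc (suc (suc n))) =
  map suc (R (suc (suc n))) ++ applyUpTo suc (suc (suc n)) ++ R (suc (suc n))

interval : ℤ → ℕ → List ℤ
interval t k = applyUpTo (λ i → t ℤ.+ + i) (suc k)

step : List ℤ × ℤ → ℕ → List ℤ × ℤ
step (G , t) j =
  (G ++ interval t (suc (v2 j)) ++ [ t ℤ.+ + v2 j ]) , (t ℤ.+ + v2 j ℤ.- + 1)

program : ℕ → List ℤ × ℤ
program m = foldl step ([ + (m ∸ 1) ] , + (m ∸ 2)) (applyUpTo suc (2 ^ (m ∸ 2) ∸ 1))

module Submission where

-- The loop of Theorem 5.1 only ever looks at j through v = v₂(j).  The
-- proof therefore has three parts.
--
--  1. Valuations.  v₂(2n) = 1 + v₂(n), v₂(odd) = 0, hence v₂(2^k) = k and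
--     v₂(2^k + i) = v₂(i) for 0 < i < 2^k.  Consequently the valuations of
--     j = 1, …, 2^k - 1 form the ruler sequence  ruler (k+1) =
--     ruler k ++ [k] ++ ruler k.
--  2. The loop driven by valuations.  Write R_{k+2} = (k+1) ∷ Rtail k.
--     Started with t = c + k, running the loop body over ruler k appends
--     Rtail k shifted up by c and ends with t = c.  This is proved by
--     induction on k, mirroring the recursive definitions of ruler and R:
--     the first half produces Rtail k shifted by c+1 (the block R_{k+1}+1),
--     the middle step with v = k appends [c+1, …, c+k+2] ∪ [c+k+1], and the
--     second half produces Rtail k shifted by c.
--  3. The theorem: for m = k + 2 the program starts with G = [k+1],
--     t = 0 + k, and runs over the valuations of 1, …, 2^k - 1 = ruler k.

open import Defs
open import Data.Nat as ℕ using (ℕ; zero; suc; _≤_; _<_; _∸_; _^_; z≤n; s≤s)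
open import Data.Nat.Properties
  using (+-suc; +-identityʳ; *-comm; *-distribˡ-+; *-cancelˡ-<; m≤m+n; m≤n+m; ≤-refl; ≤-trans; ≤-pred;
         m^n>0; m+[n∸m]≡n)
open import Data.Nat.DivMod using (_/_; _%_; [m+kn]%n≡m%n; m*n/n≡m; m/n<m)
open import Data.Integer as ℤ using (ℤ; +_)
open import Data.List using (List; []; _∷_; _++_; map; applyUpTo; foldl; [_])
open import Data.List.Properties
  using (map-applyUpTo; foldl-++; foldl-map; map-++; ++-assoc; map-∘; map-cong; ++-identityʳ)
open import Data.Product using (_×_; _,_)
open import Function using (_∘_)
open import Relation.Binary.PropositionalEquality
  using (_≡_; refl; sym; trans; cong; cong₂; subst; module ≡-Reasoning)

open ≡-Reasoning

applyUpTo-cong< : ∀ {A : Set} (f g : ℕ → A) n →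
                  (∀ i → i < n → f i ≡ g i) → applyUpTo f n ≡ applyUpTo g n
applyUpTo-cong< f g zero    f≡g = refl
applyUpTo-cong< f g (suc n) f≡g =
  cong₂ _∷_ (f≡g 0 (s≤s z≤n))
            (applyUpTo-cong< (f ∘ suc) (g ∘ suc) n (λ i i<n → f≡g (suc i) (s≤s i<n)))

applyUpTo-+ : ∀ {A : Set} (f : ℕ → A) a b →
              applyUpTo f (a ℕ.+ b) ≡ applyUpTo f a ++ applyUpTo (λ i → f (a ℕ.+ i)) b
applyUpTo-+ f zero    b = refl
applyUpTo-+ f (suc a) b = cong (f 0 ∷_) (applyUpTo-+ (f ∘ suc) a b)

upTo-doubling : ∀ a → applyUpTo suc (a ℕ.+ suc a)
                    ≡ applyUpTo suc a ++ suc a ∷ applyUpTo (λ i → suc a ℕ.+ suc i) a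
upTo-doubling a =
  trans (applyUpTo-+ suc a (suc a))
        (cong (λ x → applyUpTo suc a ++ suc x ∷ applyUpTo (λ i → suc a ℕ.+ suc i) a)
              (+-identityʳ a))

data Parity : ℕ → Set where
  even : ∀ h → Parity (2 ℕ.* h)
  odd  : ∀ h → Parity (suc (2 ℕ.* h))

parity : ∀ n → Parity n
parity zero = even 0
parity (suc n) with parity n
... | even h = odd h
... | odd h  = subst Parity (cong suc (+-suc h (h ℕ.+ 0))) (even (suc h))

v2-fuel-irrelevant : ∀ f g n → n ≤ f → n ≤ g → v2-fuel f n ≡ v2-fuel g n
v2-fuel-irrelevant zero    zero    zero    _ _ = refl
v2-fuel-irrelevant zero    (suc g) zero    _ _ = refl
v2-fuel-irrelevant (suc f) zero    zero    _ _ = refl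
v2-fuel-irrelevant (suc f) (suc g) zero    _ _ = refl
v2-fuel-irrelevant (suc f) (suc g) (suc n) (s≤s n≤f) (s≤s n≤g) with suc n % 2
... | zero  = cong suc (v2-fuel-irrelevant f g (suc n / 2) (half≤ n≤f) (half≤ n≤g))
  where
  half≤ : ∀ {x} → n ≤ x → suc n / 2 ≤ x
  half≤ n≤x = ≤-trans (≤-pred (m/n<m (suc n) 2 (s≤s (s≤s z≤n)))) n≤x
... | suc _ = refl

v2-fuel-odd : ∀ f n → suc n % 2 ≡ 1 → v2-fuel (suc f) (suc n) ≡ 0
v2-fuel-odd f n odd-rem rewrite odd-rem = refl

v2-fuel-even : ∀ f n → suc n % 2 ≡ 0 → v2-fuel (suc f) (suc n) ≡ suc (v2-fuel f (suc n / 2))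
v2-fuel-even f n even-rem rewrite even-rem = refl

v2-odd : ∀ h → v2 (suc (2 ℕ.* h)) ≡ 0
v2-odd h = v2-fuel-odd (2 ℕ.* h) (2 ℕ.* h)
  (trans (cong (λ x → suc x % 2) (*-comm 2 h)) ([m+kn]%n≡m%n 1 h 2))

v2-double : ∀ n → 0 < n → v2 (2 ℕ.* n) ≡ suc (v2 n)
v2-double (suc n) _ = begin
  v2 (2 ℕ.* suc n)
    ≡⟨ v2-fuel-even _ _ (trans (cong (_% 2) 2n≡n*2) ([m+kn]%n≡m%n 0 (suc n) 2)) ⟩
  suc (v2-fuel (ℕ.pred (2 ℕ.* suc n)) (2 ℕ.* suc n / 2))
    ≡⟨ cong (λ x → suc (v2-fuel (ℕ.pred (2 ℕ.* suc n)) x)) (trans (cong (_/ 2) 2n≡n*2) (m*n/n≡m (suc n) 2)) ⟩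
  suc (v2-fuel (ℕ.pred (2 ℕ.* suc n)) (suc n))
    ≡⟨ cong suc (v2-fuel-irrelevant _ (suc n) (suc n) n<2n ≤-refl) ⟩
  suc (v2 (suc n)) ∎
  where
  2n≡n*2 : 2 ℕ.* suc n ≡ suc n ℕ.* 2
  2n≡n*2 = *-comm 2 (suc n)
  n<2n : suc n ≤ ℕ.pred (2 ℕ.* suc n)
  n<2n = ≤-trans (s≤s (m≤m+n n 0)) (m≤n+m _ n)

v2-pow : ∀ k → v2 (2 ^ k) ≡ k
v2-pow zero    = refl
v2-pow (suc k) = trans (v2-double (2 ^ k) (m^n>0 2 k)) (cong suc (v2-pow k))

v2-shift : ∀ k i → 0 < i → i < 2 ^ k → v2 (2 ^ k ℕ.+ i) ≡ v2 i
v2-shift zero    (suc i) _ (s≤s ())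
v2-shift (suc k) i 0<i i<2^k+1 with parity i
... | odd h = begin
  v2 (2 ℕ.* 2 ^ k ℕ.+ suc (2 ℕ.* h))   ≡⟨ cong v2 (+-suc (2 ℕ.* 2 ^ k) (2 ℕ.* h)) ⟩
  v2 (suc (2 ℕ.* 2 ^ k ℕ.+ 2 ℕ.* h))   ≡⟨ cong (v2 ∘ suc) (sym (*-distribˡ-+ 2 (2 ^ k) h)) ⟩
  v2 (suc (2 ℕ.* (2 ^ k ℕ.+ h)))        ≡⟨ v2-odd (2 ^ k ℕ.+ h) ⟩
  0                                     ≡⟨ sym (v2-odd h) ⟩
  v2 (suc (2 ℕ.* h))                    ∎
... | even h = begin
  v2 (2 ℕ.* 2 ^ k ℕ.+ 2 ℕ.* h)   ≡⟨ cong v2 (sym (*-distribˡ-+ 2 (2 ^ k) h)) ⟩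
  v2 (2 ℕ.* (2 ^ k ℕ.+ h))        ≡⟨ v2-double (2 ^ k ℕ.+ h) (≤-trans (m^n>0 2 k) (m≤m+n _ h)) ⟩
  suc (v2 (2 ^ k ℕ.+ h))          ≡⟨ cong suc (v2-shift k h 0<h (*-cancelˡ-< 2 h (2 ^ k) i<2^k+1)) ⟩
  suc (v2 h)                      ≡⟨ sym (v2-double h 0<h) ⟩
  v2 (2 ℕ.* h)                    ∎
  where
  0<h : 0 < h
  0<h = *-cancelˡ-< 2 0 h 0<i

-- ruler k = [v₂(1), …, v₂(2^k - 1)], built by its self-similar recursion.
ruler : ℕ → List ℕ
ruler zero    = []
ruler (suc k) = ruler k ++ k ∷ ruler k

2^k≡1+pred : ∀ k → 2 ^ k ≡ suc (2 ^ k ∸ 1)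
2^k≡1+pred k = sym (m+[n∸m]≡n (m^n>0 2 k))

valuations-ruler : ∀ k → map v2 (applyUpTo suc (2 ^ k ∸ 1)) ≡ ruler k
valuations-ruler zero    = refl
valuations-ruler (suc k) = begin
  map v2 (applyUpTo suc (2 ^ suc k ∸ 1))
    ≡⟨ cong (map v2 ∘ applyUpTo suc) length-split ⟩
  map v2 (applyUpTo suc (a ℕ.+ suc a))
    ≡⟨ cong (map v2) (upTo-doubling a) ⟩
  map v2 (applyUpTo suc a ++ suc a ∷ applyUpTo (λ i → suc a ℕ.+ suc i) a)
    ≡⟨ map-++ v2 (applyUpTo suc a) _ ⟩
  map v2 (applyUpTo suc a) ++ v2 (suc a) ∷ map v2 (applyUpTo (λ i → suc a ℕ.+ suc i) a)
    ≡⟨ cong₂ (λ x xs → map v2 (applyUpTo suc a) ++ x ∷ xs) middle upper-half ⟩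
  map v2 (applyUpTo suc a) ++ k ∷ map v2 (applyUpTo suc a)
    ≡⟨ cong (λ xs → xs ++ k ∷ xs) (valuations-ruler k) ⟩
  ruler (suc k) ∎
  where
  a : ℕ
  a = 2 ^ k ∸ 1
  length-split : 2 ^ suc k ∸ 1 ≡ a ℕ.+ suc a
  length-split = begin
    2 ^ k ℕ.+ (2 ^ k ℕ.+ 0) ∸ 1   ≡⟨ cong (λ x → x ℕ.+ (x ℕ.+ 0) ∸ 1) (2^k≡1+pred k) ⟩
    a ℕ.+ (suc a ℕ.+ 0)           ≡⟨ cong (a ℕ.+_) (+-identityʳ (suc a)) ⟩
    a ℕ.+ suc a                   ∎
  middle : v2 (suc a) ≡ k
  middle = trans (cong v2 (sym (2^k≡1+pred k))) (v2-pow k)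
  shifted : ∀ i → i < a → v2 (suc a ℕ.+ suc i) ≡ v2 (suc i)
  shifted i i<a = subst (λ p → v2 (p ℕ.+ suc i) ≡ v2 (suc i)) (2^k≡1+pred k)
    (v2-shift k (suc i) (s≤s z≤n) (subst (suc (suc i) ≤_) (sym (2^k≡1+pred k)) (s≤s i<a)))
  upper-half : map v2 (applyUpTo (λ i → suc a ℕ.+ suc i) a) ≡ map v2 (applyUpTo suc a)
  upper-half = begin
    map v2 (applyUpTo (λ i → suc a ℕ.+ suc i) a)   ≡⟨ map-applyUpTo _ v2 a ⟩
    applyUpTo (λ i → v2 (suc a ℕ.+ suc i)) a       ≡⟨ applyUpTo-cong< _ _ a shifted ⟩
    applyUpTo (v2 ∘ suc) a                         ≡⟨ sym (map-applyUpTo suc v2 a) ⟩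
    map v2 (applyUpTo suc a)                       ∎

emitted : ℤ → ℕ → List ℤ
emitted t v = interval t (suc v) ++ [ t ℤ.+ + v ]

stepᵥ : List ℤ × ℤ → ℕ → List ℤ × ℤ
stepᵥ (G , t) v = (G ++ emitted t v , t ℤ.+ + v ℤ.- + 1)

foldl-step-valuations : ∀ s js → foldl step s js ≡ foldl stepᵥ s (map v2 js)
foldl-step-valuations s js = sym (foldl-map stepᵥ v2 s js)

-- R_{k+2} with its first entry k+1 removed, with the recursion inherited from R.
Rtail : ℕ → List ℕ
Rtail zero    = []
Rtail (suc k) = map suc (Rtail k) ++ applyUpTo suc (suc (suc k)) ++ suc k ∷ Rtail k

R≡head∷Rtail : ∀ k → R (suc (suc k)) ≡ suc k ∷ Rtail k
R≡head∷Rtail zero = refl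
R≡head∷Rtail (suc k) rewrite R≡head∷Rtail k = refl

shift : ℕ → List ℕ → List ℤ
shift c = map (λ x → + (c ℕ.+ x))

shift-suc : ∀ c xs → shift (suc c) xs ≡ shift c (map suc xs)
shift-suc c xs = trans (map-cong (λ x → cong +_ (sym (+-suc c x))) xs) (map-∘ xs)

emitted-shift : ∀ c k → emitted (+ suc c) k ≡ shift c (applyUpTo suc (suc (suc k)) ++ [ suc k ])
emitted-shift c k = begin
  applyUpTo (λ i → + (suc c ℕ.+ i)) (suc (suc k)) ++ [ + (suc c ℕ.+ k) ]
    ≡⟨ cong₂ _++_ (applyUpTo-cong< _ _ (suc (suc k)) (λ i _ → cong +_ (sym (+-suc c i))))
                  (cong (λ x → [ + x ]) (sym (+-suc c k))) ⟩
  applyUpTo (λ i → + (c ℕ.+ suc i)) (suc (suc k)) ++ [ + (c ℕ.+ suc k) ]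
    ≡⟨ cong (_++ [ + (c ℕ.+ suc k) ]) (sym (map-applyUpTo suc _ (suc (suc k)))) ⟩
  shift c (applyUpTo suc (suc (suc k))) ++ shift c [ suc k ]
    ≡⟨ sym (map-++ _ (applyUpTo suc (suc (suc k))) [ suc k ]) ⟩
  shift c (applyUpTo suc (suc (suc k)) ++ [ suc k ]) ∎

-- The recursion of Rtail, shifted by c, in the shape produced by the loop:
-- first half shifted by c+1, the middle emission, second half shifted by c.
shift-Rtail-suc : ∀ c k → shift c (Rtail (suc k))
                        ≡ shift (suc c) (Rtail k) ++ emitted (+ suc c) k ++ shift c (Rtail k)
shift-Rtail-suc c k = begin
  shift c (map suc (Rtail k) ++ middle ++ suc k ∷ Rtail k)
    ≡⟨ map-++ _ (map suc (Rtail k)) _ ⟩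
  shift c (map suc (Rtail k)) ++ shift c (middle ++ [ suc k ] ++ Rtail k)
    ≡⟨ cong₂ _++_ (sym (shift-suc c (Rtail k)))
                  (cong (shift c) (sym (++-assoc middle [ suc k ] (Rtail k)))) ⟩
  shift (suc c) (Rtail k) ++ shift c ((middle ++ [ suc k ]) ++ Rtail k)
    ≡⟨ cong (shift (suc c) (Rtail k) ++_) (map-++ _ (middle ++ [ suc k ]) (Rtail k)) ⟩
  shift (suc c) (Rtail k) ++ shift c (middle ++ [ suc k ]) ++ shift c (Rtail k)
    ≡⟨ cong (λ xs → shift (suc c) (Rtail k) ++ xs ++ shift c (Rtail k)) (sym (emitted-shift c k)) ⟩
  shift (suc c) (Rtail k) ++ emitted (+ suc c) k ++ shift c (Rtail k) ∎
  where
  middle : List ℕ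
  middle = applyUpTo suc (suc (suc k))

ruler-run : ∀ k c G → foldl stepᵥ (G , + (c ℕ.+ k)) (ruler k) ≡ (G ++ shift c (Rtail k) , + c)
ruler-run zero c G rewrite +-identityʳ c | ++-identityʳ G = refl
ruler-run (suc k) c G = begin
  foldl stepᵥ (G , + (c ℕ.+ suc k)) (ruler k ++ k ∷ ruler k)
    ≡⟨ foldl-++ stepᵥ _ (ruler k) (k ∷ ruler k) ⟩
  foldl stepᵥ (foldl stepᵥ (G , + (c ℕ.+ suc k)) (ruler k)) (k ∷ ruler k)
    ≡⟨ cong (λ x → foldl stepᵥ (foldl stepᵥ (G , + x) (ruler k)) (k ∷ ruler k)) (+-suc c k) ⟩
  foldl stepᵥ (foldl stepᵥ (G , + (suc c ℕ.+ k)) (ruler k)) (k ∷ ruler k)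
    ≡⟨ cong (λ s → foldl stepᵥ s (k ∷ ruler k)) (ruler-run k (suc c) G) ⟩
  foldl stepᵥ ((G ++ shift (suc c) (Rtail k)) ++ emitted (+ suc c) k , + (c ℕ.+ k)) (ruler k)
    ≡⟨ ruler-run k c _ ⟩
  (((G ++ shift (suc c) (Rtail k)) ++ emitted (+ suc c) k) ++ shift c (Rtail k) , + c)
    ≡⟨ cong (_, + c) reassociate ⟩
  (G ++ shift c (Rtail (suc k)) , + c) ∎
  where
  reassociate : ((G ++ shift (suc c) (Rtail k)) ++ emitted (+ suc c) k) ++ shift c (Rtail k)
              ≡ G ++ shift c (Rtail (suc k))
  reassociate = begin
    ((G ++ shift (suc c) (Rtail k)) ++ emitted (+ suc c) k) ++ shift c (Rtail k)
      ≡⟨ ++-assoc (G ++ shift (suc c) (Rtail k)) _ _ ⟩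
    (G ++ shift (suc c) (Rtail k)) ++ emitted (+ suc c) k ++ shift c (Rtail k)
      ≡⟨ ++-assoc G _ _ ⟩
    G ++ shift (suc c) (Rtail k) ++ emitted (+ suc c) k ++ shift c (Rtail k)
      ≡⟨ cong (G ++_) (sym (shift-Rtail-suc c k)) ⟩
    G ++ shift c (Rtail (suc k)) ∎

theorem5p1 : (m : ℕ) → 2 ≤ m → program m ≡ (map +_ (R m) , + 0)
theorem5p1 (suc (suc k)) (s≤s (s≤s z≤n)) = begin
  foldl step ([ + suc k ] , + k) (applyUpTo suc (2 ^ k ∸ 1))
    ≡⟨ foldl-step-valuations _ (applyUpTo suc (2 ^ k ∸ 1)) ⟩
  foldl stepᵥ ([ + suc k ] , + k) (map v2 (applyUpTo suc (2 ^ k ∸ 1)))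
    ≡⟨ cong (foldl stepᵥ ([ + suc k ] , + k)) (valuations-ruler k) ⟩
  foldl stepᵥ ([ + suc k ] , + (0 ℕ.+ k)) (ruler k)
    ≡⟨ ruler-run k 0 [ + suc k ] ⟩
  ([ + suc k ] ++ shift 0 (Rtail k) , + 0)
    ≡⟨ cong (λ xs → map +_ xs , + 0) (sym (R≡head∷Rtail k)) ⟩
  (map +_ (R (suc (suc k))) , + 0) ∎
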